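{- Let $j,k$ be positive integers, $H$ a graph, $H''$ a connected induced subgraph of $H$ with at most $j$ vertices, and $H'=H-V(H'')$ with $\chi(H')\leq k$. If $g_k(H')\leq j$ and $H''$ is $f$-choosable, where $f(v)=k-d'(v)-\min\{d'(v),j\}$ for $v\in V(H'')$, then $g_k(H)\leq j$.
   Context: $d'(v)=|N_H(v)\cap V(H')|$. Given $f$, an $f$-list assignment $L$ gives each vertex $v$ a list of $f(v)$ positive integers; an $L$-coloring is a proper coloring $\phi$ with $\phi(v)\in L(v)$; a graph is $f$-choosable if every $f$-list assignment admits an $L$-coloring. For a graph $H$ and $k\geq\chi(H)$, a proper $k$-coloring is a map $V(H)\to[k]$ giving adjacent vertices different colors; $G^j_k(H)$ has the proper $k$-colorings as vertices, two distinct colorings adjacent if $H$ contains a connected subgraph on at most $j$ vertices containing all vertices where they differ; $g_k(H)$ is the least $j\geq1$ with $G^j_k(H)$ connected. -}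

module Defs where

open import Data.Nat using (ℕ; _≤_; _∸_; _⊓_)
open import Data.Bool using (Bool; true; false)
open import Data.Fin using (Fin)
open import Data.Fin.Subset using (Subset; _∈_; _⊆_; ∣_∣; Nonempty; ∁; _∩_; ⊤)
open import Data.Vec using (tabulate)
open import Data.List using (List; length)
open import Data.List.Relation.Unary.All using (All)
open import Data.List.Relation.Unary.Unique.Propositional using (Unique)
import Data.List.Membership.Propositional as LM
open import Data.Product using (Σ; _×_; ∃; _,_)
import Data.Product
open import Relation.Binary.PropositionalEquality using (_≡_; _≢_)

record Graph (n : ℕ) : Set where
  field
    adj : Fin n → Fin n → Bool
    adj-sym : ∀ u v → adj u v ≡ adj v u
    adj-irrefl : ∀ v → adj v v ≡ false
open Graph public

module _ {n : ℕ} (G : Graph n) where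

  Nbhd : Fin n → Subset n
  Nbhd v = tabulate (adj G v)

  ProperOn : {A : Set} → Subset n → (Fin n → A) → Set
  ProperOn U c = ∀ u v → u ∈ U → v ∈ U → adj G u v ≡ true → c u ≢ c v

  -- proper k-colourings of G[U] (values outside U are irrelevant;
  -- two colourings are the same iff they agree on U)
  Coloring : Subset n → ℕ → Set
  Coloring U k = Σ (Fin n → Fin k) (ProperOn U)

  Colorable : Subset n → ℕ → Set
  Colorable U k = Coloring U k

  data WalkIn (W : Subset n) : Fin n → Fin n → Set where
    here : ∀ {u} → WalkIn W u u
    step : ∀ {u w v} → adj G u w ≡ true → w ∈ W → WalkIn W w v → WalkIn W u v

  ConnectedIn : Subset n → Set
  ConnectedIn W = Nonempty W × (∀ u v → u ∈ W → v ∈ W → WalkIn W u v)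

  -- adjacency in G^j_k(G[U]): all vertices of U where c, c' differ lie in
  -- the vertex set W ⊆ U of a connected subgraph of G[U] with ≤ j vertices
  RecolAdj : (U : Subset n) (k j : ℕ) → Coloring U k → Coloring U k → Set
  RecolAdj U k j (c , _) (c' , _) =
    Σ (Subset n) λ W → W ⊆ U × ConnectedIn W × ∣ W ∣ ≤ j ×
      (∀ v → v ∈ U → c v ≢ c' v → v ∈ W)

  data Reach (U : Subset n) (k j : ℕ) : Coloring U k → Coloring U k → Set where
    same : ∀ {c c'} → (∀ v → v ∈ U → Data.Product.proj₁ c v ≡ Data.Product.proj₁ c' v) → Reach U k j c c'
    move : ∀ {c c' c''} → RecolAdj U k j c c' → Reach U k j c' c'' → Reach U k j c c''

  RecolConnected : Subset n → ℕ → ℕ → Set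
  RecolConnected U k j = ∀ (c c' : Coloring U k) → Reach U k j c c'

  -- g_k(G[U]) ≤ j  (g_k defined only when k ≥ χ; the least i ≥ 1 with
  -- G^i_k connected is ≤ j iff some such i ≤ j exists)
  gLE : Subset n → ℕ → ℕ → Set
  gLE U k j = Colorable U k × Σ ℕ λ i → 1 ≤ i × i ≤ j × RecolConnected U k i

  Choosable : Subset n → (Fin n → ℕ) → Set
  Choosable U f =
    ∀ (L : Fin n → List ℕ) →
      (∀ v → v ∈ U → length (L v) ≡ f v × Unique (L v) × All (1 ≤_) (L v)) →
      Σ (Fin n → ℕ) λ φ → (∀ v → v ∈ U → φ v LM.∈ L v) × ProperOn U φ

  dPrime : Subset n → Fin n → ℕ
  dPrime S v = ∣ Nbhd v ∩ ∁ S ∣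

module Submission where

-- Write H' = H - S.  A proper k-colouring of H is a proper colouring of H'
-- together with colours on S avoiding the colours of outside neighbours.
-- The proof lifts each step a → b of a j-reconfiguration sequence of H'
-- (a and b differ only on a connected set W with |W| ≤ j) to H: choose one
-- colouring ψ of S that avoids, at each v ∈ S, the colours a shows on the
-- d'(v) outside neighbours of v and the colours b shows on the at most
-- min(d'(v), j) outside neighbours in W.  These are at most d'(v)+min(d'(v),j)
-- forbidden colours, so lists of f(v) allowed colours exist and
-- f-choosability of H[S] provides ψ.  Then ψ ∪ a and ψ ∪ b are proper
-- colourings of H differing only on W, and any two colourings of H agreeing
-- on H' differ only on the connected set S, |S| ≤ j.

open import Defs
open import Data.Nat using (ℕ; suc; _≤_; _∸_; _⊓_; _+_; z≤n; s≤s)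
open import Data.Nat.Properties
  using (≤-trans; ≤-refl; ≤-reflexive; +-suc; n≤1+n; +-mono-≤; +-monoʳ-≤; ⊓-monoʳ-≤;
         ∸-+-assoc; ∸-monoʳ-≤; m≤n⇒m⊓n≡m; suc-injective; module ≤-Reasoning)
open import Data.Bool using (true)
open import Data.Fin using (Fin; toℕ; _≟_) renaming (zero to fzero; suc to fsuc)
open import Data.Fin.Properties using (toℕ-injective) renaming (suc-injective to fsuc-injective)
open import Data.Fin.Subset using (Subset; outside; inside; _∈_; _∉_; ∣_∣; ∁; ⊤; ⊥; _∩_; _∪_; ⁅_⁆)
open import Data.Fin.Subset.Properties
  using (_∈?_; x∈p∪q⁺; x∈p∩q⁺; x∈p∩q⁻; x∉p⇒x∈∁p; x∈∁p⇒x∉p; x∈⁅x⁆; ∣⁅x⁆∣≡1;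
         ∣∁p∣≡n∸∣p∣; ∣p∩q∣≤∣p∣⊓∣q∣; ∈⊤; ∣⊥∣≡0)
open import Data.Vec using ([]; _∷_; tabulate; here; there)
open import Data.Vec.Properties using (lookup⇒[]=; lookup∘tabulate)
open import Data.List using (List; length; map; take) renaming ([] to []ₗ; _∷_ to _∷ₗ_)
open import Data.List.Properties using (length-map; length-take)
open import Data.List.Relation.Unary.Any using () renaming (here to hereₗ; there to thereₗ)
open import Data.List.Relation.Unary.All using (All) renaming ([] to []ₐ; _∷_ to _∷ₐ_)
import Data.List.Relation.Unary.All as All
open import Data.List.Relation.Unary.AllPairs using () renaming ([] to []ᵤ; _∷_ to _∷ᵤ_)
open import Data.List.Relation.Unary.Unique.Propositional using (Unique)
import Data.List.Relation.Unary.Unique.Propositional.Properties as Unique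
open import Data.List.Membership.Propositional using () renaming (_∈_ to _∈ₗ_)
open import Data.List.Membership.Propositional.Properties using (∈-map⁻)
open import Data.List.Relation.Binary.Sublist.Propositional.Properties using (take-⊆; Any-resp-⊆)
open import Data.Product using (Σ; _×_; ∃; _,_; proj₁; proj₂)
open import Data.Sum using (inj₁; inj₂)
open import Data.Empty using (⊥-elim)
open import Function using (_∘_)
open import Relation.Nullary using (yes; no)
open import Relation.Binary.PropositionalEquality using (_≡_; _≢_; refl; sym; trans; cong; subst; module ≡-Reasoning)

∣p∪q∣≤∣p∣+∣q∣ : ∀ {n} (p q : Subset n) → ∣ p ∪ q ∣ ≤ ∣ p ∣ + ∣ q ∣
∣p∪q∣≤∣p∣+∣q∣ []            []            = z≤n
∣p∪q∣≤∣p∣+∣q∣ (outside ∷ p) (outside ∷ q) = ∣p∪q∣≤∣p∣+∣q∣ p q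
∣p∪q∣≤∣p∣+∣q∣ (outside ∷ p) (inside ∷ q)  =
  ≤-trans (s≤s (∣p∪q∣≤∣p∣+∣q∣ p q)) (≤-reflexive (sym (+-suc ∣ p ∣ ∣ q ∣)))
∣p∪q∣≤∣p∣+∣q∣ (inside ∷ p)  (outside ∷ q) = s≤s (∣p∪q∣≤∣p∣+∣q∣ p q)
∣p∪q∣≤∣p∣+∣q∣ (inside ∷ p)  (inside ∷ q)  =
  s≤s (≤-trans (∣p∪q∣≤∣p∣+∣q∣ p q) (+-monoʳ-≤ ∣ p ∣ (n≤1+n ∣ q ∣)))

image : ∀ {n k} → (Fin n → Fin k) → Subset n → Subset k
image g []            = ⊥
image g (inside ∷ p)  = ⁅ g fzero ⁆ ∪ image (g ∘ fsuc) p
image g (outside ∷ p) = image (g ∘ fsuc) p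

∈-image : ∀ {n k} (g : Fin n → Fin k) (p : Subset n) {u} → u ∈ p → g u ∈ image g p
∈-image g (inside ∷ p)  here      = x∈p∪q⁺ (inj₁ (x∈⁅x⁆ (g fzero)))
∈-image g (inside ∷ p)  (there m) = x∈p∪q⁺ (inj₂ (∈-image (g ∘ fsuc) p m))
∈-image g (outside ∷ p) (there m) = ∈-image (g ∘ fsuc) p m

∣image∣≤ : ∀ {n k} (g : Fin n → Fin k) (p : Subset n) → ∣ image g p ∣ ≤ ∣ p ∣
∣image∣≤ {k = k} g [] = ≤-reflexive (∣⊥∣≡0 k)
∣image∣≤ g (inside ∷ p) = begin
  ∣ ⁅ g fzero ⁆ ∪ image (g ∘ fsuc) p ∣       ≤⟨ ∣p∪q∣≤∣p∣+∣q∣ ⁅ g fzero ⁆ (image (g ∘ fsuc) p) ⟩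
  ∣ ⁅ g fzero ⁆ ∣ + ∣ image (g ∘ fsuc) p ∣   ≡⟨ cong (_+ ∣ image (g ∘ fsuc) p ∣) (∣⁅x⁆∣≡1 (g fzero)) ⟩
  suc ∣ image (g ∘ fsuc) p ∣                 ≤⟨ s≤s (∣image∣≤ (g ∘ fsuc) p) ⟩
  suc ∣ p ∣                                  ∎
  where open ≤-Reasoning
∣image∣≤ g (outside ∷ p) = ∣image∣≤ (g ∘ fsuc) p

elements : ∀ {k} → Subset k → List (Fin k)
elements []            = []ₗ
elements (inside ∷ p)  = fzero ∷ₗ map fsuc (elements p)
elements (outside ∷ p) = map fsuc (elements p)

length-elements : ∀ {k} (p : Subset k) → length (elements p) ≡ ∣ p ∣
length-elements []            = refl
length-elements (inside ∷ p)  = cong suc (trans (length-map fsuc (elements p)) (length-elements p))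
length-elements (outside ∷ p) = trans (length-map fsuc (elements p)) (length-elements p)

∈-elements⁻ : ∀ {k} (p : Subset k) {x} → x ∈ₗ elements p → x ∈ p
∈-elements⁻ (inside ∷ p) (hereₗ refl) = here
∈-elements⁻ (inside ∷ p) (thereₗ m) with ∈-map⁻ fsuc m
... | y , y∈ , refl = there (∈-elements⁻ p y∈)
∈-elements⁻ (outside ∷ p) m with ∈-map⁻ fsuc m
... | y , y∈ , refl = there (∈-elements⁻ p y∈)

elements-unique : ∀ {k} (p : Subset k) → Unique (elements p)
elements-unique []            = []ᵤ
elements-unique (inside ∷ p)  = zero∉ (elements p) ∷ᵤ Unique.map⁺ fsuc-injective (elements-unique p)
  where
  zero∉ : ∀ {k} (xs : List (Fin k)) → All (fzero ≢_) (map fsuc xs)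
  zero∉ []ₗ        = []ₐ
  zero∉ (x ∷ₗ xs)  = (λ ()) ∷ₐ zero∉ xs
elements-unique (outside ∷ p) = Unique.map⁺ fsuc-injective (elements-unique p)

-- Colours c ∈ Fin k are encoded as the positive integers 1, …, k, the entries of lists.
encode : ∀ {k} → Fin k → ℕ
encode c = suc (toℕ c)

encode-injective : ∀ {k} {c d : Fin k} → encode c ≡ encode d → c ≡ d
encode-injective = toℕ-injective ∘ suc-injective

avoiding : ∀ {k} → Subset k → ℕ → List ℕ
avoiding F m = take m (map encode (elements (∁ F)))

∈-avoiding⁻ : ∀ {k} (F : Subset k) m {x} → x ∈ₗ avoiding F m → ∃ λ c → c ∉ F × x ≡ encode c
∈-avoiding⁻ F m x∈ with ∈-map⁻ encode (Any-resp-⊆ (take-⊆ m _) x∈)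
... | c , c∈ , x≡ = c , x∈∁p⇒x∉p (∈-elements⁻ (∁ F) c∈) , x≡

length-avoiding : ∀ {k} (F : Subset k) m → m ≤ k ∸ ∣ F ∣ → length (avoiding F m) ≡ m
length-avoiding {k} F m m≤ = trans (length-take m _) (m≤n⇒m⊓n≡m (begin
  m                                        ≤⟨ m≤ ⟩
  k ∸ ∣ F ∣                                ≡⟨ sym (∣∁p∣≡n∸∣p∣ F) ⟩
  ∣ ∁ F ∣                                  ≡⟨ sym (length-elements (∁ F)) ⟩
  length (elements (∁ F))                  ≡⟨ sym (length-map encode (elements (∁ F))) ⟩
  length (map encode (elements (∁ F)))     ∎))
  where open ≤-Reasoning

avoiding-unique : ∀ {k} (F : Subset k) m → Unique (avoiding F m)
avoiding-unique F m = Unique.take⁺ m (Unique.map⁺ encode-injective (elements-unique (∁ F)))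

avoiding-positive : ∀ {k} (F : Subset k) m → All (1 ≤_) (avoiding F m)
avoiding-positive F m = All.tabulate λ x∈ → positive (∈-avoiding⁻ F m x∈)
  where
  positive : ∀ {x} → ∃ (λ c → c ∉ F × x ≡ encode c) → 1 ≤ x
  positive (c , _ , refl) = s≤s z≤n

∈-Nbhd : ∀ {n} (H : Graph n) u v → adj H u v ≡ true → v ∈ Nbhd H u
∈-Nbhd H u v e = lookup⇒[]= v (tabulate (adj H u)) (trans (lookup∘tabulate (adj H u) v) e)

module Gluing {n : ℕ} (H : Graph n) (S : Subset n) where

  outerNbhd : Fin n → Subset n
  outerNbhd u = Nbhd H u ∩ ∁ S

  ∈-outerNbhd : ∀ u v → v ∉ S → adj H u v ≡ true → v ∈ outerNbhd u
  ∈-outerNbhd u v v∉S e = x∈p∩q⁺ (∈-Nbhd H u v e , x∉p⇒x∈∁p v∉S)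

  PartialColouring : ℕ → Set
  PartialColouring k = ∀ v → v ∈ S → Fin k

  ProperPartial : ∀ {k} → PartialColouring k → Set
  ProperPartial ψ = ∀ u v (u∈S : u ∈ S) (v∈S : v ∈ S) → adj H u v ≡ true → ψ u u∈S ≢ ψ v v∈S

  choose-avoiding : ∀ {k} (f : Fin n → ℕ) → Choosable H S f → (F : Fin n → Subset k) →
    (∀ v → v ∈ S → f v ≤ k ∸ ∣ F v ∣) →
    Σ (PartialColouring k) λ ψ → ProperPartial ψ × (∀ v v∈S → ψ v v∈S ∉ F v)
  choose-avoiding {k} f choosable F room = ψ , ψ-proper , ψ-avoids
    where
    L : Fin n → List ℕ
    L v = avoiding (F v) (f v)
    colouring : Σ (Fin n → ℕ) λ φ → (∀ v → v ∈ S → φ v ∈ₗ L v) × ProperOn H S φ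
    colouring = choosable L λ v v∈S →
      length-avoiding (F v) (f v) (room v v∈S) , avoiding-unique (F v) (f v) , avoiding-positive (F v) (f v)
    φ : Fin n → ℕ
    φ = proj₁ colouring
    decoded : ∀ v → v ∈ S → ∃ λ c → c ∉ F v × φ v ≡ encode c
    decoded v v∈S = ∈-avoiding⁻ (F v) (f v) (proj₁ (proj₂ colouring) v v∈S)
    ψ : PartialColouring k
    ψ v v∈S = proj₁ (decoded v v∈S)
    ψ-proper : ProperPartial ψ
    ψ-proper u v u∈S v∈S e ψu≡ψv = proj₂ (proj₂ colouring) u v u∈S v∈S e (begin
      φ u                 ≡⟨ proj₂ (proj₂ (decoded u u∈S)) ⟩
      encode (ψ u u∈S)    ≡⟨ cong encode ψu≡ψv ⟩
      encode (ψ v v∈S)    ≡⟨ sym (proj₂ (proj₂ (decoded v v∈S))) ⟩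
      φ v                 ∎)
      where open ≡-Reasoning
    ψ-avoids : ∀ v v∈S → ψ v v∈S ∉ F v
    ψ-avoids v v∈S = proj₁ (proj₂ (decoded v v∈S))

  glue : ∀ {k} → PartialColouring k → (Fin n → Fin k) → Fin n → Fin k
  glue ψ c v with v ∈? S
  ... | yes v∈S = ψ v v∈S
  ... | no  _   = c v

  glue-outside : ∀ {k} (ψ : PartialColouring k) c v → v ∉ S → glue ψ c v ≡ c v
  glue-outside ψ c v v∉S with v ∈? S
  ... | yes v∈S = ⊥-elim (v∉S v∈S)
  ... | no  _   = refl

  glue-differs : ∀ {k} (ψ : PartialColouring k) c d v → glue ψ c v ≢ glue ψ d v → v ∈ ∁ S × c v ≢ d v
  glue-differs ψ c d v ne with v ∈? S
  ... | yes _   = ⊥-elim (ne refl)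
  ... | no  v∉S = x∉p⇒x∈∁p v∉S , ne

  glue-proper : ∀ {k} (ψ : PartialColouring k) (c : Fin n → Fin k) →
    ProperPartial ψ → ProperOn H (∁ S) c →
    (∀ u v (u∈S : u ∈ S) → v ∉ S → adj H u v ≡ true → ψ u u∈S ≢ c v) →
    ProperOn H ⊤ (glue ψ c)
  glue-proper ψ c ψ-proper c-proper cross u v _ _ e with u ∈? S | v ∈? S
  ... | yes u∈S | yes v∈S = ψ-proper u v u∈S v∈S e
  ... | yes u∈S | no  v∉S = cross u v u∈S v∉S e
  ... | no  u∉S | yes v∈S = λ eq → cross v u v∈S u∉S (trans (adj-sym H v u) e) (sym eq)
  ... | no  u∉S | no  v∉S = c-proper u v (x∉p⇒x∈∁p u∉S) (x∉p⇒x∈∁p v∉S) e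

  module Forbidden {k : ℕ} (j : ℕ) (a b : Fin n → Fin k) (W : Subset n) where

    forbidden : Fin n → Subset k
    forbidden v = image a (outerNbhd v) ∪ image b (outerNbhd v ∩ W)

    ∣forbidden∣≤ : ∣ W ∣ ≤ j → ∀ v → ∣ forbidden v ∣ ≤ dPrime H S v + (dPrime H S v ⊓ j)
    ∣forbidden∣≤ W≤j v = begin
      ∣ forbidden v ∣                                         ≤⟨ ∣p∪q∣≤∣p∣+∣q∣ (image a (outerNbhd v)) _ ⟩
      ∣ image a (outerNbhd v) ∣ + ∣ image b (outerNbhd v ∩ W) ∣ ≤⟨ +-mono-≤ (∣image∣≤ a (outerNbhd v)) (∣image∣≤ b (outerNbhd v ∩ W)) ⟩
      dPrime H S v + ∣ outerNbhd v ∩ W ∣                      ≤⟨ +-monoʳ-≤ (dPrime H S v) (∣p∩q∣≤∣p∣⊓∣q∣ (outerNbhd v) W) ⟩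
      dPrime H S v + (dPrime H S v ⊓ ∣ W ∣)                   ≤⟨ +-monoʳ-≤ (dPrime H S v) (⊓-monoʳ-≤ (dPrime H S v) W≤j) ⟩
      dPrime H S v + (dPrime H S v ⊓ j)                       ∎
      where open ≤-Reasoning

    room : ∣ W ∣ ≤ j → ∀ v → k ∸ dPrime H S v ∸ (dPrime H S v ⊓ j) ≤ k ∸ ∣ forbidden v ∣
    room W≤j v = begin
      k ∸ dPrime H S v ∸ (dPrime H S v ⊓ j)     ≡⟨ ∸-+-assoc k (dPrime H S v) _ ⟩
      k ∸ (dPrime H S v + (dPrime H S v ⊓ j))   ≤⟨ ∸-monoʳ-≤ k (∣forbidden∣≤ W≤j v) ⟩
      k ∸ ∣ forbidden v ∣                       ∎
      where open ≤-Reasoning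

    forbids-a : ∀ u v → v ∈ outerNbhd u → a v ∈ forbidden u
    forbids-a u v v∈ = x∈p∪q⁺ (inj₁ (∈-image a (outerNbhd u) v∈))

    -- Where b differs from a, the vertex lies in W, so b's colour is forbidden too.
    forbids-b : (∀ v → v ∈ ∁ S → a v ≢ b v → v ∈ W) → ∀ u v → v ∈ outerNbhd u → b v ∈ forbidden u
    forbids-b changes u v v∈ with a v ≟ b v
    ... | yes a≡b = subst (_∈ forbidden u) a≡b (forbids-a u v v∈)
    ... | no  a≢b = x∈p∪q⁺ (inj₂ (∈-image b (outerNbhd u ∩ W)
                      (x∈p∩q⁺ (v∈ , changes v (proj₂ (x∈p∩q⁻ (Nbhd H u) (∁ S) v∈)) a≢b))))

  glue-avoiding : ∀ {k} (ψ : PartialColouring k) (c : Fin n → Fin k) (F : Fin n → Subset k) →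
    ProperPartial ψ → ProperOn H (∁ S) c → (∀ v v∈S → ψ v v∈S ∉ F v) →
    (∀ u v → v ∈ outerNbhd u → c v ∈ F u) → ProperOn H ⊤ (glue ψ c)
  glue-avoiding ψ c F ψ-proper c-proper avoids covers =
    glue-proper ψ c ψ-proper c-proper λ u v u∈S v∉S e ψu≡cv →
      avoids u u∈S (subst (_∈ F u) (sym ψu≡cv) (covers u v (∈-outerNbhd u v v∉S e)))

  extend-step : ∀ {k} j → Choosable H S (λ v → k ∸ dPrime H S v ∸ (dPrime H S v ⊓ j)) →
    (a b : Coloring H (∁ S) k) (W : Subset n) → ∣ W ∣ ≤ j →
    (∀ v → v ∈ ∁ S → proj₁ a v ≢ proj₁ b v → v ∈ W) →
    Σ (PartialColouring k) λ ψ → ProperOn H ⊤ (glue ψ (proj₁ a)) × ProperOn H ⊤ (glue ψ (proj₁ b))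
  extend-step {k} j choosable (a , a-proper) (b , b-proper) W W≤j changes =
    ψ , glue-avoiding ψ a forbidden ψ-proper a-proper avoids forbids-a
      , glue-avoiding ψ b forbidden ψ-proper b-proper avoids (forbids-b changes)
    where
    open Forbidden j a b W
    chosen : Σ (PartialColouring k) λ ψ → ProperPartial ψ × (∀ v v∈S → ψ v v∈S ∉ forbidden v)
    chosen = choose-avoiding _ choosable forbidden (λ v _ → room W≤j v)
    ψ : PartialColouring k
    ψ = proj₁ chosen
    ψ-proper : ProperPartial ψ
    ψ-proper = proj₁ (proj₂ chosen)
    avoids : ∀ v v∈S → ψ v v∈S ∉ forbidden v
    avoids = proj₂ (proj₂ chosen)

module Lifting {n : ℕ} (H : Graph n) (S : Subset n) {k : ℕ} (j : ℕ)
  (S-connected : ConnectedIn H S) (∣S∣≤j : ∣ S ∣ ≤ j)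
  (choosable : Choosable H S (λ v → k ∸ dPrime H S v ∸ (dPrime H S v ⊓ j))) where

  open Gluing H S

  AgreesOff : Coloring H ⊤ k → Coloring H (∁ S) k → Set
  AgreesOff x a = ∀ v → v ∈ ∁ S → proj₁ x v ≡ proj₁ a v

  recolour-S : ∀ x y (a : Coloring H (∁ S) k) → AgreesOff x a → AgreesOff y a → RecolAdj H ⊤ k j x y
  recolour-S x y a x≈a y≈a = S , (λ _ → ∈⊤) , S-connected , ∣S∣≤j , changesIn-S
    where
    changesIn-S : ∀ v → v ∈ ⊤ → proj₁ x v ≢ proj₁ y v → v ∈ S
    changesIn-S v _ ne with v ∈? S
    ... | yes v∈S = v∈S
    ... | no  v∉S = ⊥-elim (ne (trans (x≈a v (x∉p⇒x∈∁p v∉S)) (sym (y≈a v (x∉p⇒x∈∁p v∉S)))))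

  -- A reconfiguration sequence of H - S with steps of size i ≤ j lifts to one of H
  -- between any colourings extending its ends: each step a → b becomes
  -- x → ψ ∪ a (changes on S) → ψ ∪ b (changes on W).
  lift : ∀ {i} → i ≤ j → ∀ {a b} → Reach H (∁ S) k i a b →
    ∀ x y → AgreesOff x a → AgreesOff y b → Reach H ⊤ k j x y
  lift i≤j {a} (same a≈b) x y x≈a y≈b =
    move {c' = y} (recolour-S x y a x≈a (λ v v∉S → trans (y≈b v v∉S) (sym (a≈b v v∉S)))) (same λ _ _ → refl)
  lift i≤j {a} (move {c' = b} (W , _ , W-connected , ∣W∣≤i , changes) rest) x y x≈a y≈c =
    move {c' = ψ∪a} (recolour-S x ψ∪a a x≈a ψ∪a≈a)
      (move {c' = ψ∪b} W-step (lift i≤j rest ψ∪b y ψ∪b≈b y≈c))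
    where
    extension : Σ (PartialColouring k) λ ψ →
      ProperOn H ⊤ (glue ψ (proj₁ a)) × ProperOn H ⊤ (glue ψ (proj₁ b))
    extension = extend-step j choosable a b W (≤-trans ∣W∣≤i i≤j) changes
    ψ : PartialColouring k
    ψ = proj₁ extension
    ψ∪a ψ∪b : Coloring H ⊤ k
    ψ∪a = glue ψ (proj₁ a) , proj₁ (proj₂ extension)
    ψ∪b = glue ψ (proj₁ b) , proj₂ (proj₂ extension)
    ψ∪a≈a : AgreesOff ψ∪a a
    ψ∪a≈a v v∉S = glue-outside ψ (proj₁ a) v (x∈∁p⇒x∉p v∉S)
    ψ∪b≈b : AgreesOff ψ∪b b
    ψ∪b≈b v v∉S = glue-outside ψ (proj₁ b) v (x∈∁p⇒x∉p v∉S)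
    W-step : RecolAdj H ⊤ k j ψ∪a ψ∪b
    W-step = W , (λ _ → ∈⊤) , W-connected , ≤-trans ∣W∣≤i i≤j , λ v _ ne →
      let v∉S , a≢b = glue-differs ψ (proj₁ a) (proj₁ b) v ne in changes v v∉S a≢b

mainTheorem16 : {n : ℕ} (H : Graph n) (j k : ℕ) → 1 ≤ j → 1 ≤ k →
    (S : Subset n) → ConnectedIn H S → ∣ S ∣ ≤ j →
    Colorable H (∁ S) k →
    gLE H (∁ S) k j →
    Choosable H S (λ v → k ∸ dPrime H S v ∸ (dPrime H S v ⊓ j)) →
    gLE H ⊤ k j
mainTheorem16 {n} H j k 1≤j _ S S-connected ∣S∣≤j _ (c , i , _ , i≤j , reconnected) choosable =
  colouring , j , 1≤j , ≤-refl , connected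
  where
  open Gluing H S
  open Lifting H S j S-connected ∣S∣≤j choosable
  -- Extending c by the trivial step c → c (W = ∅) gives a proper k-colouring of H.
  trivial : Σ (PartialColouring k) λ ψ →
    ProperOn H ⊤ (glue ψ (proj₁ c)) × ProperOn H ⊤ (glue ψ (proj₁ c))
  trivial = extend-step j choosable c c ⊥ (subst (_≤ j) (sym (∣⊥∣≡0 n)) z≤n) (λ _ _ c≢c → ⊥-elim (c≢c refl))
  colouring : Coloring H ⊤ k
  colouring = glue (proj₁ trivial) (proj₁ c) , proj₁ (proj₂ trivial)
  restrict : Coloring H ⊤ k → Coloring H (∁ S) k
  restrict (x , x-proper) = x , λ u v _ _ → x-proper u v ∈⊤ ∈⊤
  connected : RecolConnected H ⊤ k j
  connected x y = lift i≤j (reconnected (restrict x) (restrict y)) x y (λ _ _ → refl) (λ _ _ → refl)
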